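{- Let $G$ be a Nim sequence over an additively periodic sequence $(\mathcal{Y}_x)_{x\in\mathbb{N}}$ of finite subsets of $\mathbb{Z}$ with difference bounds $M^-,M^+$, and let $d(x)=G(x)-x$. If $G$ is additively periodic with preperiod length $\tilde P$, then for all $x\ge\tilde P$, $$\min(0,M^-)\le d(x)\le\max(0,M^+).$$
   Context: $\mathbb{N}=\{0,1,2,\dots\}$. For a finite $Y\subseteq\mathbb{Z}$, $\operatorname{mex}(Y)=\min(\mathbb{N}\setminus Y)$. $(\mathcal{Y}_x)$ is additively periodic if there is $p\ge1$ with $\mathcal{Y}_{x+p}=\mathcal{Y}_x+p$ for all $x\in\mathbb{N}$. $M^+=\max\{z-x: x\in\mathbb{N}, z\in\mathcal{Y}_x\}+1$, $M^-=\min\{z-x: x\in\mathbb{N}, z\in\mathcal{Y}_x\}-1$. A Nim sequence over $(\mathcal{Y}_x)$ with seed $[g_0,\dots,g_{L-1}]$ ($g_i\in\mathbb{N}$ pairwise distinct) is $G:\mathbb{N}\to\mathbb{N}$ with $G(x)=g_x$ for $x<L$ and $G(x)=\operatorname{mex}(\{G(x'):x'<x\}\cup\mathcal{Y}_x)$ for $x\ge L$. $G$ is additively periodic if there are $\tilde P\in\mathbb{N}$, $\tilde p\ge1$ with $G(x+\tilde p)=G(x)+\tilde p$ for all $x\ge\tilde P$; the preperiod length is the least such $\tilde P$ for the least such $\tilde p$. -}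

module Defs where

open import Data.Nat using (ℕ; _+_; _<_; _≤_; _≥_)
open import Data.Integer as ℤ using (ℤ; +_; _-_)
open import Data.List using (List; length; map; lookup)
open import Data.List.Membership.Propositional using (_∈_)
open import Data.List.Relation.Unary.Unique.Propositional using (Unique)
open import Data.Fin using (fromℕ<)
open import Data.Product using (Σ; ∃; ∃-syntax; _×_)
open import Data.Sum using (_⊎_)
open import Function.Bundles using (_⇔_)
open import Relation.Binary.PropositionalEquality using (_≡_)
open import Relation.Nullary using (¬_)

FinSubsetSeq : Set
FinSubsetSeq = ℕ → List ℤ

AddPeriodicWith : FinSubsetSeq → ℕ → Set
AddPeriodicWith Y p = ∀ x z → (z ∈ Y (x + p)) ⇔ (z ∈ map (λ y → y ℤ.+ + p) (Y x))

AdditivelyPeriodicSeq : FinSubsetSeq → Set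
AdditivelyPeriodicSeq Y = Σ ℕ λ p → 1 ≤ p × AddPeriodicWith Y p

IsMPlus : FinSubsetSeq → ℤ → Set
IsMPlus Y M =
  (∀ x z → z ∈ Y x → (z - + x) ℤ.+ + 1 ℤ.≤ M) ×
  (∃[ x ] ∃[ z ] (z ∈ Y x × (z - + x) ℤ.+ + 1 ≡ M))

IsMMinus : FinSubsetSeq → ℤ → Set
IsMMinus Y M =
  (∀ x z → z ∈ Y x → M ℤ.≤ (z - + x) - + 1) ×
  (∃[ x ] ∃[ z ] (z ∈ Y x × (z - + x) - + 1 ≡ M))

IsMex : (ℤ → Set) → ℕ → Set
IsMex S m = ¬ S (+ m) × (∀ k → k < m → S (+ k))

IsNimSequence : FinSubsetSeq → (g : List ℕ) → (ℕ → ℕ) → Set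
IsNimSequence Y g G =
  Unique g ×
  (∀ x → (x<L : x < length g) → G x ≡ lookup g (fromℕ< x<L)) ×
  (∀ x → length g ≤ x →
     IsMex (λ z → (∃[ x' ] (x' < x × + G x' ≡ z)) ⊎ z ∈ Y x) (G x))

AddPeriodicFrom : (ℕ → ℕ) → ℕ → ℕ → Set
AddPeriodicFrom G P p = ∀ x → x ≥ P → G (x + p) ≡ G x + p

IsPreperiodLength : (ℕ → ℕ) → ℕ → Set
IsPreperiodLength G P =
  ∃[ p ] ( 1 ≤ p
         × (∃[ P' ] AddPeriodicFrom G P' p)
         × (∀ p' → 1 ≤ p' → p' < p → ∀ P' → ¬ AddPeriodicFrom G P' p')
         × AddPeriodicFrom G P p
         × (∀ P' → P' < P → ¬ AddPeriodicFrom G P' p))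

-- Write d(x) = G(x) − x.  G is injective (the seed is repetition-free and a mex avoids earlier
-- values), and additive periodicity makes d periodic on x ≥ P̃, so d attains its maximum there and
-- every natural number m is a value of G: for X large, m < G(X) and Y_X lies above m, so m is an
-- earlier value.
--   If d(z+1) < M⁻, then G(z+1) < G(z) is impossible (G(z+1) would be an earlier value or lie in
-- Y_z), so d(z) ≤ d(z+1).  Hence d(x₀) < min(0, M⁻) propagates down from the translates of x₀ to
-- give G(x) < x on a whole tail, which no injection allows.
--   If the maximum of d exceeds max(0, M⁺) at z+1, then G(z+1) − 1 is not in Y_{z+1}, and by
-- maximality the only earlier argument that can take this value is z; so d(z) = d(z+1).  Hence
-- d is a positive constant on a tail, G(x) > x there, and some small value has no preimage.

module Submission where

open import Defs
open import Data.Nat using (ℕ; _≥_)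
open import Data.Integer using (ℤ; +_; _-_; _≤_; _⊓_; _⊔_; 0ℤ)
open import Data.List using (List)
open import Data.Product using (_×_)

open import Data.Nat as ℕ using (zero; suc; pred; _+_; _*_; _∸_; >-nonZero)
import Data.Nat.Properties as ℕ
open import Data.Nat.DivMod using (_%_; _/_; m≡m%n+[m/n]*n; m%n<n)
open import Data.Integer as ℤ using (-[1+_]; _<_; _⊖_; ∣_∣; -<+; -<-)
import Data.Integer.Properties as ℤ
open import Data.List using (_∷_; length; lookup)
open import Data.List.Membership.Propositional using (_∈_; _∉_)
open import Data.List.Membership.Propositional.Properties using (∈-lookup)
import Data.List.Relation.Unary.All as All
open import Data.List.Relation.Unary.AllPairs using (_∷_)
open import Data.List.Relation.Unary.Unique.Propositional using (Unique)
open import Data.Fin as Fin using (fromℕ<; toℕ)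
import Data.Fin.Properties as Fin
open import Data.Product using (∃-syntax; _,_; proj₁; proj₂)
open import Data.Sum using (_⊎_; inj₁; inj₂)
import Data.Sum as Sum
open import Data.Empty using (⊥-elim)
open import Function.Definitions using (Injective)
open import Relation.Binary.Definitions using (tri<; tri≈; tri>)
open import Relation.Nullary using (¬_; yes; no; contradiction)
open import Relation.Binary.PropositionalEquality

lookup-injective : ∀ {A : Set} {xs : List A} → Unique xs → Injective _≡_ _≡_ (lookup xs)
lookup-injective {xs = _ ∷ _} _          {Fin.zero}  {Fin.zero}  _  = refl
lookup-injective {xs = _ ∷ _} (x∉ ∷ _)   {Fin.zero}  {Fin.suc j} eq =
  contradiction eq (All.lookup x∉ (∈-lookup j))
lookup-injective {xs = _ ∷ _} (x∉ ∷ _)   {Fin.suc i} {Fin.zero}  eq =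
  contradiction (sym eq) (All.lookup x∉ (∈-lookup i))
lookup-injective {xs = _ ∷ _} (_ ∷ uniq) {Fin.suc i} {Fin.suc j} eq = cong Fin.suc (lookup-injective uniq eq)

pigeonhole : ∀ {m n} → n ℕ.< m → (f : ℕ → ℕ) → (∀ x → x ℕ.< m → f x ℕ.< n) → ¬ Injective _≡_ _≡_ f
pigeonhole n<m f f< f-inj with Fin.pigeonhole n<m (λ i → fromℕ< (f< (toℕ i) (Fin.toℕ<n i)))
... | i , j , i<j , eq = ℕ.<-irrefl (f-inj (Fin.fromℕ<-injective _ _ _ _ eq)) i<j

<-suc-elim : {Q : ℕ → Set} {n : ℕ} → (∀ x → x ℕ.< n → Q x) → Q n → ∀ x → x ℕ.< suc n → Q x
<-suc-elim below at x x<1+n with ℕ.m≤n⇒m<n∨m≡n (ℕ.s≤s⁻¹ x<1+n)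
... | inj₁ x<n  = below x x<n
... | inj₂ refl = at

prefix-bound : (f : ℕ → ℕ) (n : ℕ) → ∃[ B ] (∀ x → x ℕ.< n → f x ℕ.< B)
prefix-bound f zero = 0 , λ _ ()
prefix-bound f (suc n) with prefix-bound f n
... | B , f<B = suc (f n) + B ,
  <-suc-elim (λ x x<n → ℕ.<-≤-trans (f<B x x<n) (ℕ.m≤n+m B (suc (f n)))) (ℕ.m≤m+n (suc (f n)) B)

eventually-below-id⇒¬injective : (f : ℕ → ℕ) (b : ℕ) → (∀ x → b ℕ.≤ x → f x ℕ.< x) →
                                 ¬ Injective _≡_ _≡_ f
eventually-below-id⇒¬injective f b below = pigeonhole (ℕ.n<1+n (b + B)) f into-prefix
  where
  B : ℕ
  B = proj₁ (prefix-bound f b)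
  into-prefix : ∀ x → x ℕ.< suc (b + B) → f x ℕ.< b + B
  into-prefix x x<1+b+B with b ℕ.≤? x
  ... | yes b≤x = ℕ.<-≤-trans (below x b≤x) (ℕ.s≤s⁻¹ x<1+b+B)
  ... | no  b≰x = ℕ.<-≤-trans (proj₂ (prefix-bound f b) x (ℕ.≰⇒> b≰x)) (ℕ.m≤n+m B b)

eventually-above⇒¬surjective : (f : ℕ → ℕ) (b : ℕ) → (∀ x → b ℕ.≤ x → b ℕ.< f x) →
                               ¬ (∀ y → ∃[ x ] f x ≡ y)
eventually-above⇒¬surjective f b above surj =
  pigeonhole (ℕ.n<1+n b) preimage preimage<b preimage-injective
  where
  preimage : ℕ → ℕ
  preimage y = proj₁ (surj y)
  preimage-injective : Injective _≡_ _≡_ preimage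
  preimage-injective {y} {y'} eq = trans (sym (proj₂ (surj y))) (trans (cong f eq) (proj₂ (surj y')))
  preimage<b : ∀ y → y ℕ.< suc b → preimage y ℕ.< b
  preimage<b y y≤b = ℕ.≰⇒> λ b≤preimage →
    ℕ.<⇒≱ (subst (b ℕ.<_) (proj₂ (surj y)) (above (preimage y) b≤preimage)) (ℕ.s≤s⁻¹ y≤b)

backward-induction : (Q : ℕ → Set) {b t : ℕ} → b ℕ.≤ t →
                     (∀ z → b ℕ.≤ z → Q (suc z) → Q z) → Q t → Q b
backward-induction Q {b} {t} b≤t step Qt = go (t ∸ b) b ℕ.≤-refl (ℕ.m+[n∸m]≡n b≤t)
  where
  go : ∀ k z → b ℕ.≤ z → z + k ≡ t → Q z
  go zero    z _   z+0≡t = subst Q (trans (sym z+0≡t) (ℕ.+-identityʳ z)) Qt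
  go (suc k) z b≤z z+k≡t = step z b≤z (go k (suc z) (ℕ.m≤n⇒m≤1+n b≤z) (trans (sym (ℕ.+-suc z k)) z+k≡t))

residue-decomposition : ∀ p .{{_ : ℕ.NonZero p}} {b x} → b ℕ.≤ x →
                        x ≡ b + (x ∸ b) % p + ((x ∸ b) / p) * p
residue-decomposition p {b} {x} b≤x = begin
  x                                   ≡⟨ ℕ.m+[n∸m]≡n b≤x ⟨
  b + (x ∸ b)                         ≡⟨ cong (λ r → b + r) (m≡m%n+[m/n]*n (x ∸ b) p) ⟩
  b + ((x ∸ b) % p + (x ∸ b) / p * p) ≡⟨ ℕ.+-assoc b _ _ ⟨
  b + (x ∸ b) % p + (x ∸ b) / p * p   ∎
  where open ≡-Reasoning

argmax : (f : ℕ → ℤ) (n : ℕ) → ∃[ y ] (∀ x → x ℕ.< suc n → f x ≤ f y)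
argmax f zero = 0 , <-suc-elim (λ _ ()) ℤ.≤-refl
argmax f (suc n) with argmax f n
... | y , max with ℤ.≤-total (f (suc n)) (f y)
...   | inj₁ f[1+n]≤fy = y , <-suc-elim max f[1+n]≤fy
...   | inj₂ fy≤f[1+n] = suc n , <-suc-elim (λ x x<1+n → ℤ.≤-trans (max x x<1+n) fy≤f[1+n]) ℤ.≤-refl

⊖-cancelʳ-≥-≤ : ∀ m {n o} → m ⊖ n ≤ m ⊖ o → o ℕ.≤ n
⊖-cancelʳ-≥-≤ m m⊖n≤m⊖o = ℕ.≮⇒≥ λ n<o → ℤ.<⇒≱ (ℤ.⊖-monoʳ->-< m n<o) m⊖n≤m⊖o

⊖-cancelˡ-< : ∀ {m n} o → m ⊖ o < n ⊖ o → m ℕ.< n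
⊖-cancelˡ-< o m⊖o<n⊖o = ℕ.≰⇒> λ n≤m → ℤ.<⇒≱ m⊖o<n⊖o (ℤ.⊖-monoˡ-≤ o n≤m)

0<m⊖n⇒n<m : ∀ {m n} → 0ℤ < m ⊖ n → n ℕ.< m
0<m⊖n⇒n<m {m} {n} 0<m⊖n = ⊖-cancelˡ-< n (subst (_< m ⊖ n) (sym (ℤ.n⊖n≡0 n)) 0<m⊖n)

m⊖n<0⇒m<n : ∀ {m n} → m ⊖ n < 0ℤ → m ℕ.< n
m⊖n<0⇒m<n {m} {n} m⊖n<0 = ⊖-cancelˡ-< n (subst (m ⊖ n <_) (sym (ℤ.n⊖n≡0 n)) m⊖n<0)

+-cancelʳ-⊖ : ∀ m n o → (m + o) ⊖ (n + o) ≡ m ⊖ n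
+-cancelʳ-⊖ m n o = begin
  (m + o) ⊖ (n + o) ≡⟨ cong₂ _⊖_ (ℕ.+-comm m o) (ℕ.+-comm n o) ⟩
  (o + m) ⊖ (o + n) ≡⟨ ℤ.+-cancelˡ-⊖ o m n ⟩
  m ⊖ n             ∎
  where open ≡-Reasoning

m⊖[m+1+n]≡-[1+n] : ∀ m n → m ⊖ (m + suc n) ≡ -[1+ n ]
m⊖[m+1+n]≡-[1+n] m n = begin
  m ⊖ (m + suc n)       ≡⟨ cong (_⊖ (m + suc n)) (ℕ.+-identityʳ m) ⟨
  (m + 0) ⊖ (m + suc n) ≡⟨ ℤ.+-cancelˡ-⊖ m 0 (suc n) ⟩
  -[1+ n ]              ∎
  where open ≡-Reasoning

-[1+∣i∣]<i : ∀ i → -[1+ ∣ i ∣ ] < i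
-[1+∣i∣]<i (+ n)    = -<+
-[1+∣i∣]<i -[1+ n ] = -<- (ℕ.n<1+n n)

[+m-+n]-1≡m⊖1+n : ∀ m n → (+ m - + n) - + 1 ≡ m ⊖ suc n
[+m-+n]-1≡m⊖1+n m n = begin
  (+ m - + n) - + 1  ≡⟨ cong (_- + 1) (ℤ.[+m]-[+n]≡m⊖n m n) ⟩
  m ⊖ n - + 1        ≡⟨ ℤ.distribˡ-⊖-+-neg 0 m n ⟩
  m ⊖ (suc n + 0)    ≡⟨ cong (m ⊖_) (ℕ.+-identityʳ (suc n)) ⟩
  m ⊖ suc n          ∎
  where open ≡-Reasoning

[+m-+n]+1≡1+m⊖n : ∀ m n → (+ m - + n) ℤ.+ + 1 ≡ suc m ⊖ n
[+m-+n]+1≡1+m⊖n m n = begin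
  (+ m - + n) ℤ.+ + 1  ≡⟨ cong (ℤ._+ + 1) (ℤ.[+m]-[+n]≡m⊖n m n) ⟩
  m ⊖ n ℤ.+ + 1        ≡⟨ ℤ.distribˡ-⊖-+-pos 1 m n ⟩
  (m + 1) ⊖ n          ≡⟨ cong (_⊖ n) (ℕ.+-comm m 1) ⟩
  suc m ⊖ n            ∎
  where open ≡-Reasoning

module PeriodicNimSequence
  (Y : FinSubsetSeq) (Mm Mp : ℤ)
  (M⁻-bound : ∀ x z → z ∈ Y x → Mm ≤ (z - + x) - + 1)
  (M⁺-bound : ∀ x z → z ∈ Y x → (z - + x) ℤ.+ + 1 ≤ Mp)
  (g : List ℕ) (G : ℕ → ℕ) (nim : IsNimSequence Y g G)
  (P p : ℕ) .{{_ : ℕ.NonZero p}} (periodic : AddPeriodicFrom G P p)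
  where

  private
    L : ℕ
    L = length g
    unique-seed : Unique g
    unique-seed = proj₁ nim
    G-seed : ∀ x (x<L : x ℕ.< L) → G x ≡ lookup g (fromℕ< x<L)
    G-seed = proj₁ (proj₂ nim)
    G-mex : ∀ x → L ℕ.≤ x → IsMex (λ z → (∃[ x' ] (x' ℕ.< x × + G x' ≡ z)) ⊎ z ∈ Y x) (G x)
    G-mex = proj₂ (proj₂ nim)

  d : ℕ → ℤ
  d x = G x ⊖ x

  below-mex : ∀ {x m} → L ℕ.≤ x → m ℕ.< G x → (∃[ x' ] (x' ℕ.< x × G x' ≡ m)) ⊎ + m ∈ Y x
  below-mex {x} L≤x m<Gx =
    Sum.map₁ (λ (x' , x'<x , eq) → x' , x'<x , ℤ.+-injective eq) (proj₂ (G-mex x L≤x) _ m<Gx)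

  <⇒G≢ : ∀ {x y} → x ℕ.< y → G x ≢ G y
  <⇒G≢ {x} {y} x<y Gx≡Gy with L ℕ.≤? y
  ... | yes L≤y = proj₁ (G-mex y L≤y) (inj₁ (x , x<y , cong +_ Gx≡Gy))
  ... | no  L≰y =
    ℕ.<-irrefl (Fin.fromℕ<-injective x y x<L y<L (lookup-injective unique-seed seed-eq)) x<y
    where
    y<L : y ℕ.< L
    y<L = ℕ.≰⇒> L≰y
    x<L : x ℕ.< L
    x<L = ℕ.<-trans x<y y<L
    seed-eq : lookup g (fromℕ< x<L) ≡ lookup g (fromℕ< y<L)
    seed-eq = trans (sym (G-seed x x<L)) (trans Gx≡Gy (G-seed y y<L))

  G-injective : Injective _≡_ _≡_ G
  G-injective {x} {y} Gx≡Gy with ℕ.<-cmp x y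
  ... | tri< x<y _ _ = contradiction Gx≡Gy (<⇒G≢ x<y)
  ... | tri≈ _ x≡y _ = x≡y
  ... | tri> _ _ y<x = contradiction (sym Gx≡Gy) (<⇒G≢ y<x)

  ∈Y⇒M⁻≤ : ∀ {w x} → + w ∈ Y x → Mm ≤ w ⊖ suc x
  ∈Y⇒M⁻≤ {w} {x} w∈Y = subst (Mm ≤_) ([+m-+n]-1≡m⊖1+n w x) (M⁻-bound x (+ w) w∈Y)

  ∈Y⇒≤M⁺ : ∀ {v x} → + v ∈ Y x → suc v ⊖ x ≤ Mp
  ∈Y⇒≤M⁺ {v} {x} v∈Y = subst (_≤ Mp) ([+m-+n]+1≡1+m⊖n v x) (M⁺-bound x (+ v) v∈Y)

  ∉Y-far : ∀ {m X} → m + ∣ Mm ∣ ℕ.≤ X → + m ∉ Y X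
  ∉Y-far {m} {X} m+∣Mm∣≤X m∈Y = ℤ.<⇒≱ far-below (∈Y⇒M⁻≤ m∈Y)
    where
    far-below : m ⊖ suc X < Mm
    far-below = ℤ.≤-<-trans
      (subst (m ⊖ suc X ≤_) (m⊖[m+1+n]≡-[1+n] m ∣ Mm ∣)
        (ℤ.⊖-monoʳ-≥-≤ m (subst (ℕ._≤ suc X) (sym (ℕ.+-suc m _)) (ℕ.s≤s m+∣Mm∣≤X))))
      (-[1+∣i∣]<i Mm)

  G-periodic : ∀ k {x} → P ℕ.≤ x → G (x + k * p) ≡ G x + k * p
  G-periodic zero    {x} _   = trans (cong G (ℕ.+-identityʳ x)) (sym (ℕ.+-identityʳ (G x)))
  G-periodic (suc k) {x} P≤x = begin
    G (x + (p + k * p)) ≡⟨ cong G (ℕ.+-assoc x p (k * p)) ⟨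
    G (x + p + k * p)   ≡⟨ G-periodic k (ℕ.≤-trans P≤x (ℕ.m≤m+n x p)) ⟩
    G (x + p) + k * p   ≡⟨ cong (_+ k * p) (periodic x P≤x) ⟩
    G x + p + k * p     ≡⟨ ℕ.+-assoc (G x) p (k * p) ⟩
    G x + (p + k * p)   ∎
    where open ≡-Reasoning

  d-periodic : ∀ k {x} → P ℕ.≤ x → d (x + k * p) ≡ d x
  d-periodic k {x} P≤x = begin
    G (x + k * p) ⊖ (x + k * p) ≡⟨ cong (_⊖ (x + k * p)) (G-periodic k P≤x) ⟩
    (G x + k * p) ⊖ (x + k * p) ≡⟨ +-cancelʳ-⊖ (G x) x (k * p) ⟩
    G x ⊖ x                     ∎
    where open ≡-Reasoning

  d-max : ∃[ t ] (P ℕ.≤ t × ∀ x → P ℕ.≤ x → d x ≤ d t)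
  d-max with argmax (λ i → d (P + i)) p
  ... | i , max = P + i , ℕ.m≤m+n P i , λ x P≤x → begin
    d x                                     ≡⟨ cong d (residue-decomposition p P≤x) ⟩
    d (P + (x ∸ P) % p + (x ∸ P) / p * p)   ≡⟨ d-periodic ((x ∸ P) / p) (ℕ.m≤m+n P _) ⟩
    d (P + (x ∸ P) % p)                     ≤⟨ max _ (ℕ.m<n⇒m<1+n (m%n<n (x ∸ P) p)) ⟩
    d (P + i)                               ∎
    where open ℤ.≤-Reasoning

  G-unbounded : ∀ m b → ∃[ X ] (b ℕ.≤ X × m ℕ.< G X)
  G-unbounded m b = X₀ + suc m * p , ℕ.≤-trans (ℕ.m≤m⊔n b P) (ℕ.m≤m+n X₀ _) , m<G[X₀+[1+m]p]
    where
    X₀ : ℕ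
    X₀ = b ℕ.⊔ P
    m<G[X₀+[1+m]p] : m ℕ.< G (X₀ + suc m * p)
    m<G[X₀+[1+m]p] = subst (m ℕ.<_) (sym (G-periodic (suc m) (ℕ.m≤n⊔m b P)))
      (ℕ.≤-trans (ℕ.m≤m*n (suc m) p) (ℕ.m≤n+m _ (G X₀)))

  G-surjective : ∀ m → ∃[ x ] G x ≡ m
  G-surjective m with G-unbounded m (L ℕ.⊔ (m + ∣ Mm ∣))
  ... | X , L⊔[m+∣Mm∣]≤X , m<GX with below-mex (ℕ.≤-trans (ℕ.m≤m⊔n _ _) L⊔[m+∣Mm∣]≤X) m<GX
  ...   | inj₁ (x , _ , Gx≡m) = x , Gx≡m
  ...   | inj₂ m∈Y           = contradiction m∈Y (∉Y-far (ℕ.≤-trans (ℕ.m≤n⊔m _ _) L⊔[m+∣Mm∣]≤X))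

  d-step-lower : ∀ {z} → L ℕ.≤ z → d (suc z) < Mm → d z ≤ d (suc z)
  d-step-lower {z} L≤z d[1+z]<Mm with ℕ.<-cmp (G z) (G (suc z))
  ... | tri< Gz<G[1+z] _ _ =
    subst (_≤ d (suc z)) (ℤ.[1+m]⊖[1+n]≡m⊖n (G z) z) (ℤ.⊖-monoˡ-≤ (suc z) Gz<G[1+z])
  ... | tri≈ _ Gz≡G[1+z] _ = contradiction (sym (G-injective Gz≡G[1+z])) ℕ.1+n≢n
  ... | tri> _ _ G[1+z]<Gz with below-mex L≤z G[1+z]<Gz
  ...   | inj₁ (x' , x'<z , Gx'≡G[1+z]) =
    contradiction (G-injective Gx'≡G[1+z]) (ℕ.<⇒≢ (ℕ.m<n⇒m<1+n x'<z))
  ...   | inj₂ G[1+z]∈Y                 = contradiction (∈Y⇒M⁻≤ G[1+z]∈Y) (ℤ.<⇒≱ d[1+z]<Mm)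

  d-lower-bound : ∀ x → P ℕ.≤ x → 0ℤ ⊓ Mm ≤ d x
  d-lower-bound x₀ P≤x₀ with 0ℤ ⊓ Mm ℤ.≤? d x₀
  ... | yes bound = bound
  ... | no  d≱    = ⊥-elim (eventually-below-id⇒¬injective G L below-id G-injective)
    where
    dx₀<0⊓Mm : d x₀ < 0ℤ ⊓ Mm
    dx₀<0⊓Mm = ℤ.≰⇒> d≱
    step : ∀ z → L ℕ.≤ z → d (suc z) ≤ d x₀ → d z ≤ d x₀
    step z L≤z d[1+z]≤dx₀ = ℤ.≤-trans (d-step-lower L≤z d[1+z]<Mm) d[1+z]≤dx₀
      where
      d[1+z]<Mm : d (suc z) < Mm
      d[1+z]<Mm = ℤ.≤-<-trans d[1+z]≤dx₀ (ℤ.<-≤-trans dx₀<0⊓Mm (ℤ.i⊓j≤j 0ℤ Mm))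
    d≤dx₀ : ∀ x → L ℕ.≤ x → d x ≤ d x₀
    d≤dx₀ x L≤x = backward-induction (λ z → d z ≤ d x₀) (ℕ.≤-trans (ℕ.m≤m*n x p) (ℕ.m≤n+m _ x₀))
      (λ z x≤z → step z (ℕ.≤-trans L≤x x≤z)) (ℤ.≤-reflexive (d-periodic x P≤x₀))
    below-id : ∀ x → L ℕ.≤ x → G x ℕ.< x
    below-id x L≤x = m⊖n<0⇒m<n (ℤ.≤-<-trans (d≤dx₀ x L≤x) (ℤ.<-≤-trans dx₀<0⊓Mm (ℤ.i⊓j≤i 0ℤ Mm)))

  d-step-upper : ∀ {z B} → L ℕ.≤ z → (∀ x → x ℕ.< P → G x ℕ.< B) → B ℕ.≤ z →
                 (∀ x → P ℕ.≤ x → d x ≤ d (suc z)) → 0ℤ ⊔ Mp < d (suc z) → d z ≡ d (suc z)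
  d-step-upper {z} {B} L≤z G<B B≤z maximal exceeds =
    from-mex (below-mex (ℕ.m≤n⇒m≤1+n L≤z) v<G[1+z])
    where
    1+z<G[1+z] : suc z ℕ.< G (suc z)
    1+z<G[1+z] = 0<m⊖n⇒n<m (ℤ.≤-<-trans (ℤ.i≤i⊔j 0ℤ Mp) exceeds)
    v : ℕ
    v = pred (G (suc z))
    1+v≡G[1+z] : suc v ≡ G (suc z)
    1+v≡G[1+z] = ℕ.suc-pred (G (suc z)) {{>-nonZero (ℕ.<-trans ℕ.z<s 1+z<G[1+z])}}
    v<G[1+z] : v ℕ.< G (suc z)
    v<G[1+z] = subst (v ℕ.<_) 1+v≡G[1+z] (ℕ.n<1+n v)
    z<v : z ℕ.< v
    z<v = ℕ.s<s⁻¹ (subst (suc z ℕ.<_) (sym 1+v≡G[1+z]) 1+z<G[1+z])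
    d[1+z]≡v⊖z : d (suc z) ≡ v ⊖ z
    d[1+z]≡v⊖z = trans (cong (_⊖ suc z) (sym 1+v≡G[1+z])) (ℤ.[1+m]⊖[1+n]≡m⊖n v z)

    from-mex : (∃[ x' ] (x' ℕ.< suc z × G x' ≡ v)) ⊎ + v ∈ Y (suc z) → d z ≡ d (suc z)
    from-mex (inj₂ v∈Y) = contradiction (subst (λ w → w ⊖ suc z ≤ Mp) 1+v≡G[1+z] (∈Y⇒≤M⁺ v∈Y))
                                        (ℤ.<⇒≱ (ℤ.≤-<-trans (ℤ.i≤j⊔i 0ℤ Mp) exceeds))
    from-mex (inj₁ (x' , x'<1+z , Gx'≡v)) = begin
      d z       ≡⟨ cong d x'≡z ⟨
      d x'      ≡⟨ cong (_⊖ x') Gx'≡v ⟩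
      v ⊖ x'    ≡⟨ cong (v ⊖_) x'≡z ⟩
      v ⊖ z     ≡⟨ d[1+z]≡v⊖z ⟨
      d (suc z) ∎
      where
      open ≡-Reasoning
      P≤x' : P ℕ.≤ x'
      P≤x' = ℕ.≮⇒≥ λ x'<P → ℕ.<-irrefl Gx'≡v (ℕ.<-≤-trans (G<B x' x'<P) (ℕ.≤-trans B≤z (ℕ.<⇒≤ z<v)))
      z≤x' : z ℕ.≤ x'
      z≤x' = ⊖-cancelʳ-≥-≤ v (subst₂ _≤_ (cong (_⊖ x') Gx'≡v) d[1+z]≡v⊖z (maximal x' P≤x'))
      x'≡z : x' ≡ z
      x'≡z = ℕ.≤-antisym (ℕ.s≤s⁻¹ x'<1+z) z≤x'

  d-upper-bound : ∀ x → P ℕ.≤ x → d x ≤ 0ℤ ⊔ Mp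
  d-upper-bound x₀ P≤x₀ with d x₀ ℤ.≤? 0ℤ ⊔ Mp
  ... | yes bound = bound
  ... | no  d≰ with d-max | prefix-bound G P
  ...   | t , P≤t , t-max | B , G<B = ⊥-elim (eventually-above⇒¬surjective G b above-id G-surjective)
    where
    b : ℕ
    b = L ℕ.⊔ B
    0⊔Mp<dt : 0ℤ ⊔ Mp < d t
    0⊔Mp<dt = ℤ.<-≤-trans (ℤ.≰⇒> d≰) (t-max x₀ P≤x₀)
    step : ∀ z → b ℕ.≤ z → d t ≤ d (suc z) → d t ≤ d z
    step z b≤z dt≤d[1+z] = subst (d t ≤_) (sym d[z]≡d[1+z]) dt≤d[1+z]
      where
      d[z]≡d[1+z] : d z ≡ d (suc z)
      d[z]≡d[1+z] = d-step-upper (ℕ.≤-trans (ℕ.m≤m⊔n L B) b≤z) G<B (ℕ.≤-trans (ℕ.m≤n⊔m L B) b≤z)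
        (λ y P≤y → ℤ.≤-trans (t-max y P≤y) dt≤d[1+z]) (ℤ.<-≤-trans 0⊔Mp<dt dt≤d[1+z])
    dt≤d : ∀ x → b ℕ.≤ x → d t ≤ d x
    dt≤d x b≤x = backward-induction (λ z → d t ≤ d z) (ℕ.≤-trans (ℕ.m≤m*n x p) (ℕ.m≤n+m _ t))
      (λ z x≤z → step z (ℕ.≤-trans b≤x x≤z)) (ℤ.≤-reflexive (sym (d-periodic x P≤t)))
    above-id : ∀ x → b ℕ.≤ x → b ℕ.< G x
    above-id x b≤x = ℕ.≤-<-trans b≤x (0<m⊖n⇒n<m (ℤ.<-≤-trans 0<dt (dt≤d x b≤x)))
      where
      0<dt : 0ℤ < d t
      0<dt = ℤ.≤-<-trans (ℤ.i≤i⊔j 0ℤ Mp) 0⊔Mp<dt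

corollaryc : (Y : FinSubsetSeq) → AdditivelyPeriodicSeq Y →
    (Mp Mm : ℤ) → IsMPlus Y Mp → IsMMinus Y Mm →
    (g : List ℕ) (G : ℕ → ℕ) → IsNimSequence Y g G →
    (P : ℕ) → IsPreperiodLength G P →
    ∀ x → x ≥ P → (0ℤ ⊓ Mm ≤ + G x - + x) × (+ G x - + x ≤ 0ℤ ⊔ Mp)
corollaryc Y _ Mp Mm (M⁺-bound , _) (M⁻-bound , _) g G nim P (p , 1≤p , _ , _ , periodic , _) x P≤x
  rewrite ℤ.[+m]-[+n]≡m⊖n (G x) x = d-lower-bound x P≤x , d-upper-bound x P≤x
  where open PeriodicNimSequence Y Mm Mp M⁻-bound M⁺-bound g G nim P p {{>-nonZero 1≤p}} periodic
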